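{- Let $q\ge1$, $S\subseteq[q]^3$, and $a,b\in[q]$ with $a\neq b$, and assume that $H_q(a,b;S)$ holds. Let $X:=L_q(S)\subseteq[2q]^3$ and \[ T:=\bigl(X\cup\{P_1,P_2,P_3\}\bigr)\setminus\{M_1,M_2,M_3,M_4\}\subseteq[2q]^3, \] where $P_1=(2b,2b,2b+1)$, $P_2=(2b+1,2b,2b+1)$, $P_3=(2b+1,2a+1,2a)$, $M_1=(2a+1,2a,2a)$, $M_2=(2a+1,2a,2a+1)$, $M_3=(2b,2b+1,2a)$, $M_4=(2b,2b+1,2a+1)$. Set $a':=2a+1$ and $b':=2b+1$. Then $H_{2q}(a',b';T)$ holds.
   Context: $[q]:=\{0,\dots,q-1\}$. For $S\subseteq[q]^3$ and $u,v\in[q]$: $I_S(u,v):=\#\{x\in[q]:(x,u,v)\in S\}$ and $O_S(u,v):=\#\{y\in[q]:(u,v,y)\in S\}$. The dyadic lift $L_q(S)\subseteq[2q]^3$ is defined by $(r,s,t)\in L_q(S)$ iff $(\lfloor r/2\rfloor,\lfloor s/2\rfloor,\lfloor t/2\rfloor)\in S$. For $a\ne b$ in $[q]$, the condition $H_q(a,b;S)$ means: (i) $(a,a,a)\in S$, $(b,b,a)\in S$, $(b,a,a)\notin S$, $(b,b,b)\notin S$; (ii) $I_S(a,a)+O_S(a,a)=q$; (iii) $I_S(b,b)+O_S(b,b)=q$; (iv) $I_S(b,b)+O_S(b,a)=q-1$; (v) $I_S(b,a)+O_S(a,a)=q+1$. (For $H_{2q}(a',b';T)$ the same conditions are taken with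 $q$ replaced by $2q$, $S$ by $T$, and $a,b$ by $a',b'$.) -}

module Defs where

open import Data.Nat using (ℕ; _*_; _+_; _∸_)
open import Data.Bool using (Bool; true; false; _∧_; _∨_; not)
open import Data.Fin using (Fin; zero; suc; quotient; combine)
open import Data.Fin.Properties using (_≟_)
open import Data.List using (filter; length)
open import Data.Vec using (allFin; toList)
open import Data.Product using (_×_)
open import Relation.Nullary.Decidable using (⌊_⌋)
open import Relation.Binary.PropositionalEquality using (_≡_)
import Data.Bool as B

Subset3 : ℕ → Set
Subset3 q = Fin q → Fin q → Fin q → Bool

_∈₃_ : ∀ {q} → Fin q × Fin q × Fin q → Subset3 q → Set
(x Data.Product., y Data.Product., z) ∈₃ S = S x y z ≡ true

count : (q : ℕ) → (Fin q → Bool) → ℕ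
count q p = length (filter (λ x → p x B.≟ true) (toList (allFin q)))

I : ∀ {q} → Subset3 q → Fin q → Fin q → ℕ
I {q} S u v = count q (λ x → S x u v)

O : ∀ {q} → Subset3 q → Fin q → Fin q → ℕ
O {q} S u v = count q (λ y → S u v y)

-- [2q] is represented as Fin (q * 2); stdlib's encoding has
-- toℕ (combine i j) = 2 * toℕ i + toℕ j  and  toℕ (quotient 2 r) = ⌊ toℕ r / 2 ⌋.
half : ∀ {q} → Fin (q * 2) → Fin q
half {q} r = quotient {q} 2 r

dbl dbl1 : ∀ {q} → Fin q → Fin (q * 2)
dbl  u = combine u zero
dbl1 u = combine u (suc zero)

L : ∀ {q} → Subset3 q → Subset3 (q * 2)
L S r s t = S (half r) (half s) (half t)

eq3 : ∀ {n} → Fin n × Fin n × Fin n → Fin n → Fin n → Fin n → Bool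
eq3 (x Data.Product., y Data.Product., z) r s t = ⌊ x ≟ r ⌋ ∧ ⌊ y ≟ s ⌋ ∧ ⌊ z ≟ t ⌋

record H (q : ℕ) (a b : Fin q) (S : Subset3 q) : Set where
  field
    i-aaa : S a a a ≡ true
    i-bba : S b b a ≡ true
    i-baa : S b a a ≡ false
    i-bbb : S b b b ≡ false
    ii    : I S a a + O S a a ≡ q
    iii   : I S b b + O S b b ≡ q
    iv    : I S b b + O S b a ≡ q ∸ 1
    v     : I S b a + O S a a ≡ q + 1

T : ∀ {q} → Subset3 q → Fin q → Fin q → Subset3 (q * 2)
T S a b r s t =
  (L S r s t ∨ eq3 P1 r s t ∨ eq3 P2 r s t ∨ eq3 P3 r s t)
  ∧ not (eq3 M1 r s t ∨ eq3 M2 r s t ∨ eq3 M3 r s t ∨ eq3 M4 r s t)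
  where
  open Data.Product using (_,_)
  P1 = dbl b  , dbl b  , dbl1 b
  P2 = dbl1 b , dbl b  , dbl1 b
  P3 = dbl1 b , dbl1 a , dbl a
  M1 = dbl1 a , dbl a  , dbl a
  M2 = dbl1 a , dbl a  , dbl1 a
  M3 = dbl b  , dbl1 b , dbl a
  M4 = dbl b  , dbl1 b , dbl1 a

-- T agrees with the lift L_q(S) except at the seven points P₁, P₂, P₃, M₁, …, M₄, and the lift
-- doubles every count, since the fibre over u ∈ [q] is {2u, 2u+1}. The lines counted in (ii) and
-- (iii) avoid all seven points, so both counts double and so do the sums q. In (iv) and (v) the line
-- (b′, a′, ·) gains P₃, which the lift lacks because (b,a,a) ∉ S, and the line (·, b′, a′) loses M₄,
-- which the lift contains because (b,b,a) ∈ S; so the sums become 2(q − 1) + 1 and 2(q + 1) − 1.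
-- The membership conditions (i) are read off lines on which T and the lift agree.
module Submission where

open import Defs
open import Data.Nat using (ℕ; zero; suc; _*_; _+_; _∸_; _≥_; s≤s)
open import Data.Nat.Properties using (+-suc; *-distribʳ-+; suc-injective)
open import Data.Nat.Tactic.RingSolver using (solve-∀)
open import Data.Bool using (Bool; true; false; _∧_; _∨_; not; if_then_else_)
open import Data.Bool.Properties
  using (∧-identityʳ; ∧-zeroʳ; ∨-identityʳ; ∨-zeroʳ) renaming (_≟_ to _≟ᵇ_)
open import Data.Fin using (Fin; zero; suc; combine)
import Data.Fin.Properties as Fin
open import Data.Fin.Properties using (_≟_; remQuot-combine; combine-injectiveˡ; combine-injectiveʳ)
open import Data.List using (filter; length)
open import Data.Vec using (toList; tabulate)
open import Data.Product using (_,_; proj₁; proj₂)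
open import Data.Empty using (⊥-elim)
open import Function using (_∘_)
open import Relation.Nullary.Decidable using (⌊_⌋; yes; no; isYes≗does; dec-true)
open import Relation.Binary.PropositionalEquality
  using (_≡_; _≢_; refl; sym; trans; cong; cong₂; module ≡-Reasoning)

open ≡-Reasoning

count-tabulate : ∀ {k} n (g : Fin n → Fin k) (p : Fin k → Bool) →
  length (filter (λ x → p x ≟ᵇ true) (toList (tabulate g))) ≡ count n (p ∘ g)
count-tabulate zero    g p = refl
count-tabulate (suc n) g p with p (g zero)
... | true  = cong suc (trans (count-tabulate n (g ∘ suc) p) (sym (count-tabulate n suc (p ∘ g))))
... | false = trans (count-tabulate n (g ∘ suc) p) (sym (count-tabulate n suc (p ∘ g)))

count-suc : ∀ n (p : Fin (suc n) → Bool) →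
  count (suc n) p ≡ (if p zero then 1 else 0) + count n (p ∘ suc)
count-suc n p with p zero
... | true  = cong suc (count-tabulate n suc p)
... | false = count-tabulate n suc p

count-cong : ∀ n {p p′ : Fin n → Bool} → (∀ u → p u ≡ p′ u) → count n p ≡ count n p′
count-cong zero    eq = refl
count-cong (suc n) {p} {p′} eq rewrite count-suc n p | count-suc n p′ | eq zero =
  cong ((if p′ zero then 1 else 0) +_) (count-cong n (eq ∘ suc))

count-flip : ∀ n (p p′ : Fin n → Bool) (c : Fin n) → p c ≡ false → p′ c ≡ true →
  (∀ u → u ≢ c → p′ u ≡ p u) → count n p′ ≡ suc (count n p)
count-flip (suc n) p p′ zero pc p′c agree rewrite count-suc n p | count-suc n p′ | pc | p′c =
  cong suc (count-cong n (λ u → agree (suc u) λ ()))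
count-flip (suc n) p p′ (suc c) pc p′c agree
  rewrite count-suc n p | count-suc n p′ | agree zero (λ ()) = begin
    (if p zero then 1 else 0) + count n (p′ ∘ suc)      ≡⟨ cong ((if p zero then 1 else 0) +_) tail-flip ⟩
    (if p zero then 1 else 0) + suc (count n (p ∘ suc)) ≡⟨ +-suc _ _ ⟩
    suc ((if p zero then 1 else 0) + count n (p ∘ suc)) ∎
  where
  tail-flip : count n (p′ ∘ suc) ≡ suc (count n (p ∘ suc))
  tail-flip = count-flip n (p ∘ suc) (p′ ∘ suc) c pc p′c
    (λ u u≢c → agree (suc u) (u≢c ∘ Fin.suc-injective))

count-split : ∀ q (p : Fin (q * 2) → Bool) →
  count (q * 2) p ≡ count q (p ∘ dbl) + count q (p ∘ dbl1)
count-split zero    p = refl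
count-split (suc q) p = begin
  count (suc q * 2) p                                ≡⟨ count-suc _ p ⟩
  e + count (suc (q * 2)) (p ∘ suc)                  ≡⟨ cong (e +_) (count-suc _ (p ∘ suc)) ⟩
  e + (o + count (q * 2) p₊₂)                        ≡⟨ cong (λ c → e + (o + c)) (count-split q p₊₂) ⟩
  e + (o + (evens + odds))                           ≡⟨ interchange e o evens odds ⟩
  (e + evens) + (o + odds)                           ≡⟨ cong₂ _+_ (count-suc q (p ∘ dbl))
                                                                  (count-suc q (p ∘ dbl1)) ⟨
  count (suc q) (p ∘ dbl) + count (suc q) (p ∘ dbl1) ∎
  where
  p₊₂ : Fin (q * 2) → Bool
  p₊₂ x = p (suc (suc x))
  e o evens odds : ℕ
  e     = if p zero then 1 else 0
  o     = if p (suc zero) then 1 else 0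
  evens = count q (p ∘ dbl ∘ suc)
  odds  = count q (p ∘ dbl1 ∘ suc)
  interchange : ∀ w x y z → w + (x + (y + z)) ≡ (w + y) + (x + z)
  interchange = solve-∀

half-combine : ∀ {q} (u : Fin q) (i : Fin 2) → half (combine u i) ≡ u
half-combine u i = cong proj₁ (remQuot-combine u i)

count-half : ∀ q (p : Fin q → Bool) → count (q * 2) (p ∘ half) ≡ count q p * 2
count-half q p = begin
  count (q * 2) (p ∘ half)                            ≡⟨ count-split q (p ∘ half) ⟩
  count q (p ∘ half ∘ dbl) + count q (p ∘ half ∘ dbl1) ≡⟨ cong₂ _+_ (count-cong q (cong p ∘ half-even))
                                                                    (count-cong q (cong p ∘ half-odd)) ⟩
  count q p + count q p                               ≡⟨ double (count q p) ⟩
  count q p * 2                                       ∎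
  where
  half-even : ∀ u → half (dbl u) ≡ u
  half-even u = half-combine u zero
  half-odd : ∀ u → half (dbl1 u) ≡ u
  half-odd u = half-combine u (suc zero)
  double : ∀ n → n + n ≡ n * 2
  double = solve-∀

L-combine : ∀ {q} (S : Subset3 q) r s t (i j k : Fin 2) →
  L S (combine r i) (combine s j) (combine t k) ≡ S r s t
L-combine S r s t i j k rewrite half-combine r i | half-combine s j | half-combine t k = refl

eq3-refl : ∀ {n} (x y z : Fin n) → eq3 (x , y , z) x y z ≡ true
eq3-refl x y z rewrite isYes≗does (x ≟ x) | dec-true (x ≟ x) refl
                     | isYes≗does (y ≟ y) | dec-true (y ≟ y) refl
                     | isYes≗does (z ≟ z) | dec-true (z ≟ z) refl = refl

eq3-false : ∀ {n} {x y z r s t : Fin n} →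
  (x , y , z) ≢ (r , s , t) → eq3 (x , y , z) r s t ≡ false
eq3-false {x = x} {y} {z} {r} {s} {t} ne with x ≟ r | y ≟ s | z ≟ t
... | yes refl | yes refl | yes refl = ⊥-elim (ne refl)
... | no _     | _        | _        = refl
... | yes _    | no _     | _        = refl
... | yes _    | yes _    | no _     = refl

≢₁ : ∀ {n} {x y z r s t : Fin n} → x ≢ r → (x , y , z) ≢ (r , s , t)
≢₁ x≢r = x≢r ∘ cong proj₁

≢₂ : ∀ {n} {x y z r s t : Fin n} → y ≢ s → (x , y , z) ≢ (r , s , t)
≢₂ y≢s = y≢s ∘ cong (proj₁ ∘ proj₂)

≢₃ : ∀ {n} {x y z r s t : Fin n} → z ≢ t → (x , y , z) ≢ (r , s , t)
≢₃ z≢t = z≢t ∘ cong (proj₂ ∘ proj₂)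

dbl≢dbl1 : ∀ {q} (u v : Fin q) → dbl u ≢ dbl1 v
dbl≢dbl1 u v eq with () ← combine-injectiveʳ u zero v (suc zero) eq

dbl1≢dbl : ∀ {q} (u v : Fin q) → dbl1 u ≢ dbl v
dbl1≢dbl u v = dbl≢dbl1 v u ∘ sym

dbl1-injective : ∀ {q} {u v : Fin q} → dbl1 u ≡ dbl1 v → u ≡ v
dbl1-injective {u = u} {v} = combine-injectiveˡ u (suc zero) v (suc zero)

module _ {q} (S : Subset3 q) (a b : Fin q) where

  T-unmodified : ∀ {r s t} →
    (dbl b  , dbl b  , dbl1 b) ≢ (r , s , t) →
    (dbl1 b , dbl b  , dbl1 b) ≢ (r , s , t) →
    (dbl1 b , dbl1 a , dbl a)  ≢ (r , s , t) →
    (dbl1 a , dbl a  , dbl a)  ≢ (r , s , t) →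
    (dbl1 a , dbl a  , dbl1 a) ≢ (r , s , t) →
    (dbl b  , dbl1 b , dbl a)  ≢ (r , s , t) →
    (dbl b  , dbl1 b , dbl1 a) ≢ (r , s , t) →
    T S a b r s t ≡ L S r s t
  T-unmodified {r} {s} {t} p₁ p₂ p₃ m₁ m₂ m₃ m₄ = unmodified (L S r s t)
    (eq3-false p₁) (eq3-false p₂) (eq3-false p₃)
    (eq3-false m₁) (eq3-false m₂) (eq3-false m₃) (eq3-false m₄)
    where
    unmodified : ∀ x {p₁ p₂ p₃ m₁ m₂ m₃ m₄} →
      p₁ ≡ false → p₂ ≡ false → p₃ ≡ false →
      m₁ ≡ false → m₂ ≡ false → m₃ ≡ false → m₄ ≡ false →
      (x ∨ p₁ ∨ p₂ ∨ p₃) ∧ not (m₁ ∨ m₂ ∨ m₃ ∨ m₄) ≡ x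
    unmodified x refl refl refl refl refl refl refl = trans (∧-identityʳ _) (∨-identityʳ x)

  T-added : ∀ {r s t} →
    (dbl1 b , dbl1 a , dbl a)  ≡ (r , s , t) →
    (dbl1 a , dbl a  , dbl a)  ≢ (r , s , t) →
    (dbl1 a , dbl a  , dbl1 a) ≢ (r , s , t) →
    (dbl b  , dbl1 b , dbl a)  ≢ (r , s , t) →
    (dbl b  , dbl1 b , dbl1 a) ≢ (r , s , t) →
    T S a b r s t ≡ true
  T-added {r} {s} {t} refl m₁ m₂ m₃ m₄ = added (L S r s t)
    (eq3 (dbl b , dbl b , dbl1 b) r s t) (eq3 (dbl1 b , dbl b , dbl1 b) r s t) (eq3-refl r s t)
    (eq3-false m₁) (eq3-false m₂) (eq3-false m₃) (eq3-false m₄)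
    where
    added : ∀ x p₁ p₂ {p₃ m₁ m₂ m₃ m₄} → p₃ ≡ true →
      m₁ ≡ false → m₂ ≡ false → m₃ ≡ false → m₄ ≡ false →
      (x ∨ p₁ ∨ p₂ ∨ p₃) ∧ not (m₁ ∨ m₂ ∨ m₃ ∨ m₄) ≡ true
    added x p₁ p₂ refl refl refl refl refl rewrite ∨-zeroʳ p₂ | ∨-zeroʳ p₁ | ∨-zeroʳ x = refl

  T-removed : T S a b (dbl b) (dbl1 b) (dbl1 a) ≡ false
  T-removed = removed _
    (eq3 (dbl1 a , dbl a , dbl a) r s t) (eq3 (dbl1 a , dbl a , dbl1 a) r s t)
    (eq3 (dbl b , dbl1 b , dbl a) r s t) (eq3-refl r s t)
    where
    r s t : Fin (q * 2)
    r = dbl b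
    s = dbl1 b
    t = dbl1 a
    removed : ∀ x m₁ m₂ m₃ {m₄} → m₄ ≡ true → x ∧ not (m₁ ∨ m₂ ∨ m₃ ∨ m₄) ≡ false
    removed x m₁ m₂ m₃ refl rewrite ∨-zeroʳ m₃ | ∨-zeroʳ m₂ | ∨-zeroʳ m₁ = ∧-zeroʳ x

I-lift : ∀ {q} (S : Subset3 q) (u v : Fin q) → I (L S) (dbl1 u) (dbl1 v) ≡ I S u v * 2
I-lift {q} S u v = begin
  count (q * 2) (λ x → L S x (dbl1 u) (dbl1 v))  ≡⟨ count-cong (q * 2) (λ x → cong₂ (S (half x))
                                                      (half-combine u (suc zero)) (half-combine v (suc zero))) ⟩
  count (q * 2) (λ x → S (half x) u v)          ≡⟨ count-half q (λ x → S x u v) ⟩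
  I S u v * 2                                   ∎

O-lift : ∀ {q} (S : Subset3 q) (u v : Fin q) → O (L S) (dbl1 u) (dbl1 v) ≡ O S u v * 2
O-lift {q} S u v = begin
  count (q * 2) (λ y → L S (dbl1 u) (dbl1 v) y)  ≡⟨ count-cong (q * 2) (λ y → cong₂ (λ u′ v′ → S u′ v′ (half y))
                                                      (half-combine u (suc zero)) (half-combine v (suc zero))) ⟩
  count (q * 2) (λ y → S u v (half y))          ≡⟨ count-half q (S u v) ⟩
  O S u v * 2                                   ∎

module _ {q} (S : Subset3 q) {a b : Fin q} (a≢b : a ≢ b) where

  private
    a′ b′ : Fin (q * 2)
    a′ = dbl1 a
    b′ = dbl1 b
    a′≢b′ : a′ ≢ b′
    a′≢b′ = a≢b ∘ dbl1-injective
    b′≢a′ : b′ ≢ a′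
    b′≢a′ = a′≢b′ ∘ sym

  T-column-a′a′ : ∀ x → T S a b x a′ a′ ≡ L S x a′ a′
  T-column-a′a′ x = T-unmodified S a b
    (≢₂ (dbl≢dbl1 b a)) (≢₂ (dbl≢dbl1 b a)) (≢₃ (dbl≢dbl1 a a))
    (≢₂ (dbl≢dbl1 a a)) (≢₂ (dbl≢dbl1 a a)) (≢₂ b′≢a′) (≢₂ b′≢a′)

  T-row-a′a′ : ∀ z → T S a b a′ a′ z ≡ L S a′ a′ z
  T-row-a′a′ z = T-unmodified S a b
    (≢₁ (dbl≢dbl1 b a)) (≢₁ b′≢a′) (≢₁ b′≢a′)
    (≢₂ (dbl≢dbl1 a a)) (≢₂ (dbl≢dbl1 a a)) (≢₁ (dbl≢dbl1 b a)) (≢₁ (dbl≢dbl1 b a))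

  T-column-b′b′ : ∀ x → T S a b x b′ b′ ≡ L S x b′ b′
  T-column-b′b′ x = T-unmodified S a b
    (≢₂ (dbl≢dbl1 b b)) (≢₂ (dbl≢dbl1 b b)) (≢₂ a′≢b′)
    (≢₂ (dbl≢dbl1 a b)) (≢₂ (dbl≢dbl1 a b)) (≢₃ (dbl≢dbl1 a b)) (≢₃ a′≢b′)

  T-row-b′b′ : ∀ z → T S a b b′ b′ z ≡ L S b′ b′ z
  T-row-b′b′ z = T-unmodified S a b
    (≢₁ (dbl≢dbl1 b b)) (≢₂ (dbl≢dbl1 b b)) (≢₂ a′≢b′)
    (≢₁ a′≢b′) (≢₁ a′≢b′) (≢₁ (dbl≢dbl1 b b)) (≢₁ (dbl≢dbl1 b b))

  T-row-b′a′ : ∀ z → z ≢ dbl a → T S a b b′ a′ z ≡ L S b′ a′ z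
  T-row-b′a′ z z≢2a = T-unmodified S a b
    (≢₁ (dbl≢dbl1 b b)) (≢₂ (dbl≢dbl1 b a)) (≢₃ (z≢2a ∘ sym))
    (≢₁ a′≢b′) (≢₁ a′≢b′) (≢₁ (dbl≢dbl1 b b)) (≢₁ (dbl≢dbl1 b b))

  T-column-b′a′ : ∀ x → x ≢ dbl b → T S a b x b′ a′ ≡ L S x b′ a′
  T-column-b′a′ x x≢2b = T-unmodified S a b
    (≢₂ (dbl≢dbl1 b b)) (≢₂ (dbl≢dbl1 b b)) (≢₂ a′≢b′)
    (≢₂ (dbl≢dbl1 a b)) (≢₂ (dbl≢dbl1 a b)) (≢₃ (dbl≢dbl1 a a)) (≢₁ (x≢2b ∘ sym))

  I-T-a′a′ : I (T S a b) a′ a′ ≡ I S a a * 2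
  I-T-a′a′ = trans (count-cong (q * 2) T-column-a′a′) (I-lift S a a)

  O-T-a′a′ : O (T S a b) a′ a′ ≡ O S a a * 2
  O-T-a′a′ = trans (count-cong (q * 2) T-row-a′a′) (O-lift S a a)

  I-T-b′b′ : I (T S a b) b′ b′ ≡ I S b b * 2
  I-T-b′b′ = trans (count-cong (q * 2) T-column-b′b′) (I-lift S b b)

  O-T-b′b′ : O (T S a b) b′ b′ ≡ O S b b * 2
  O-T-b′b′ = trans (count-cong (q * 2) T-row-b′b′) (O-lift S b b)

  O-T-b′a′ : S b a a ≡ false → O (T S a b) b′ a′ ≡ suc (O S b a * 2)
  O-T-b′a′ baa∉S = trans
    (count-flip (q * 2) (L S b′ a′) (T S a b b′ a′) (dbl a) (trans (L-combine S b a a _ _ _) baa∉S)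
      (T-added S a b refl (≢₁ a′≢b′) (≢₁ a′≢b′) (≢₁ (dbl≢dbl1 b b)) (≢₁ (dbl≢dbl1 b b)))
      T-row-b′a′)
    (cong suc (O-lift S b a))

  I-T-b′a′ : S b b a ≡ true → suc (I (T S a b) b′ a′) ≡ I S b a * 2
  I-T-b′a′ bba∈S = trans
    (sym (count-flip (q * 2) (λ x → T S a b x b′ a′) (λ x → L S x b′ a′) (dbl b)
      (T-removed S a b) (trans (L-combine S b b a _ _ _) bba∈S) (λ x x≢2b → sym (T-column-b′a′ x x≢2b))))
    (I-lift S b a)

sum-of-doubles : ∀ {x y k} m n → x ≡ m * 2 → y ≡ n * 2 → m + n ≡ k → x + y ≡ k * 2
sum-of-doubles m n refl refl refl = sym (*-distribʳ-+ 2 m n)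

sum-of-doubles-suc : ∀ {x y k} m n → k ≥ 1 →
  x ≡ m * 2 → y ≡ suc (n * 2) → m + n ≡ k ∸ 1 → x + y ≡ k * 2 ∸ 1
sum-of-doubles-suc m n (s≤s _) refl refl refl =
  trans (+-suc (m * 2) (n * 2)) (cong suc (sym (*-distribʳ-+ 2 m n)))

sum-of-doubles-pred : ∀ {x y k} m n →
  suc x ≡ m * 2 → y ≡ n * 2 → m + n ≡ k + 1 → x + y ≡ k * 2 + 1
sum-of-doubles-pred {x} {y} {k} m n sx y≡ m+n≡ = suc-injective (begin
  suc (x + y)   ≡⟨ sum-of-doubles m n sx y≡ m+n≡ ⟩
  (k + 1) * 2   ≡⟨ *-distribʳ-+ 2 k 1 ⟩
  k * 2 + 2     ≡⟨ +-suc (k * 2) 1 ⟩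
  suc (k * 2 + 1) ∎)

proposition3p6 : (q : ℕ) → q ≥ 1 → (S : Subset3 q) → (a b : Fin q) → a ≢ b →
    H q a b S → H (q * 2) (dbl1 a) (dbl1 b) (T S a b)
proposition3p6 q q≥1 S a b a≢b h = record
  { i-aaa = trans (T-column-a′a′ S a≢b (dbl1 a)) (trans (L-combine S a a a _ _ _) i-aaa)
  ; i-bba = trans (T-column-b′a′ S a≢b (dbl1 b) (dbl1≢dbl b b)) (trans (L-combine S b b a _ _ _) i-bba)
  ; i-baa = trans (T-row-b′a′ S a≢b (dbl1 a) (dbl1≢dbl a a)) (trans (L-combine S b a a _ _ _) i-baa)
  ; i-bbb = trans (T-column-b′b′ S a≢b (dbl1 b)) (trans (L-combine S b b b _ _ _) i-bbb)
  ; ii    = sum-of-doubles (I S a a) (O S a a) (I-T-a′a′ S a≢b) (O-T-a′a′ S a≢b) ii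
  ; iii   = sum-of-doubles (I S b b) (O S b b) (I-T-b′b′ S a≢b) (O-T-b′b′ S a≢b) iii
  ; iv    = sum-of-doubles-suc (I S b b) (O S b a) q≥1 (I-T-b′b′ S a≢b) (O-T-b′a′ S a≢b i-baa) iv
  ; v     = sum-of-doubles-pred (I S b a) (O S a a) (I-T-b′a′ S a≢b i-bba) (O-T-a′a′ S a≢b) v
  }
  where open H h
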